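{- Let $k,l\ge1$ with $k\ne l$ and let $r$ be an odd integer with $1\le r\le 4kl$. Let $\overline{\mathcal{B}}(2k,2l;r)$ be the set of boards in $\mathcal{B}(2k,2l;r)$ whose board partition $(\lambda_1,\lambda_2,\lambda_3,\lambda_4)$ satisfies: (i) $\lambda_1\ge\lambda_i$ for all $i>1$; (ii) if $\lambda_1=\lambda_2$ then $\lambda_3\ge\lambda_4$; (iii) if $\lambda_1=\lambda_3$ then $\lambda_2\ge\lambda_4$; (iv) if $\lambda_1=\lambda_4$ then $\lambda_2\ge\lambda_3$. Then $\overline{\mathcal{B}}(2k,2l;r)$ contains exactly one board from each equivalence class of $\mathcal{B}(2k,2l;r)$ under $G=\{R_0,H,V,R_{180}\}$.
   Context: A $2k\times 2l$ grid has cells $(i,j)$, $1\le i\le 2k$ (row from top), $1\le j\le 2l$ (column from left). $\mathcal{B}(2k,2l;r)$ is the set of all choices of exactly $r$ blocked cells. $G$ acts by identity, reflection across the horizontal midline, reflection across the vertical midline, and rotation by 180 degrees; equivalence classes are $G$-orbits. The board partition $(\lambda_1,\lambda_2,\lambda_3,\lambda_4)$ counts blocked cells in the upper-left (rows $1..k$, columns $1..l$), upper-right (rows $1..k$, columns $l+1..2l$), lower-right (rows $k+1..2k$, columns $l+1..2l$) and lower-left (rows $k+1..2k$, columns $1..l$) quadrants. -}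

module Defs where

open import Data.Bool using (Bool; true; false; _∧_; if_then_else_)
open import Data.Nat using (ℕ; zero; suc; _+_; _*_; _≤_; _≥_; _<ᵇ_; _%_)
open import Data.Fin using (Fin; toℕ; opposite)
open import Data.Vec using (Vec; lookup; tabulate; allFin; map; sum)
open import Data.Product using (Σ; ∃; _×_; _,_)
open import Relation.Binary.PropositionalEquality using (_≡_)

-- A board on an m × n grid: entry (i , j) is true iff cell (i+1 , j+1) is blocked
-- (rows from top, columns from left; Fin is 0-indexed).
Board : ℕ → ℕ → Set
Board m n = Vec (Vec Bool n) m

blocked : ∀ {m n} → Board m n → Fin m → Fin n → Bool
blocked b i j = lookup (lookup b i) j

countWhere : ∀ {m n} → (Fin m → Fin n → Bool) → Board m n → ℕ
countWhere {m} {n} P b =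
  sum (map (λ i → sum (map (λ j → if blocked b i j ∧ P i j then 1 else 0) (allFin n))) (allFin m))

size : ∀ {m n} → Board m n → ℕ
size = countWhere (λ _ _ → true)

data G : Set where
  R0 H V R180 : G

-- H: reflection across horizontal midline (row i ↦ 2k+1-i);
-- V: reflection across vertical midline (column j ↦ 2l+1-j); R180: both.
act : ∀ {m n} → G → Board m n → Board m n
act R0   b = b
act H    b = tabulate λ i → tabulate λ j → blocked b (opposite i) j
act V    b = tabulate λ i → tabulate λ j → blocked b i (opposite j)
act R180 b = tabulate λ i → tabulate λ j → blocked b (opposite i) (opposite j)

SameOrbit : ∀ {m n} → Board m n → Board m n → Set
SameOrbit b b' = ∃ λ (g : G) → act g b ≡ b'

InB : ∀ {m n} → ℕ → Board m n → Set
InB r b = size b ≡ r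

λ₁ λ₂ λ₃ λ₄ : (k l : ℕ) → Board (2 * k) (2 * l) → ℕ
λ₁ k l = countWhere (λ i j → (toℕ i <ᵇ k) ∧ (toℕ j <ᵇ l))              -- upper-left
λ₂ k l = countWhere (λ i j → (toℕ i <ᵇ k) ∧ (l <ᵇ suc (toℕ j)))        -- upper-right
λ₃ k l = countWhere (λ i j → (k <ᵇ suc (toℕ i)) ∧ (l <ᵇ suc (toℕ j)))  -- lower-right
λ₄ k l = countWhere (λ i j → (k <ᵇ suc (toℕ i)) ∧ (toℕ j <ᵇ l))        -- lower-left

InBbar : (k l r : ℕ) → Board (2 * k) (2 * l) → Set
InBbar k l r b =
  InB r b ×
  (λ₁ k l b ≥ λ₂ k l b × λ₁ k l b ≥ λ₃ k l b × λ₁ k l b ≥ λ₄ k l b) ×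
  (λ₁ k l b ≡ λ₂ k l b → λ₃ k l b ≥ λ₄ k l b) ×
  (λ₁ k l b ≡ λ₃ k l b → λ₂ k l b ≥ λ₄ k l b) ×
  (λ₁ k l b ≡ λ₄ k l b → λ₂ k l b ≥ λ₃ k l b)

Odd : ℕ → Set
Odd r = r % 2 ≡ 1

{-# OPTIONS --safe #-}
-- G acts on boards, and through the quadrant counts it acts on board partitions: H sends
-- (λ₁,λ₂,λ₃,λ₄) to (λ₄,λ₃,λ₂,λ₁), V to (λ₂,λ₁,λ₄,λ₃) and R180 to (λ₃,λ₄,λ₁,λ₂); conditions
-- (i)–(iv) only involve the partition. The lexicographically largest partition in an orbit
-- satisfies (i)–(iv), which gives existence. If a partition u and its image f u both satisfy
-- (i)–(iv), the conditions force f u = u; but a non-identity f fixes only partitions of the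
-- shape (a,b,b,a), (a,a,c,c) or (a,b,a,b), whose total is even, while the total is the odd
-- number r. So f is the identity, and the two boards come from the same element of G.
module Submission where

open import Defs
open import Data.Nat using (ℕ; _*_; _≤_)
open import Data.Product using (Σ; _×_)
open import Relation.Binary.PropositionalEquality using (_≡_; _≢_)

open import Data.Bool using (Bool; true; false; not; _∧_; _xor_; if_then_else_)
open import Data.Bool.Properties using (∧-assoc; not-involutive)
open import Data.Fin using (Fin; toℕ; opposite)
import Data.Fin as Fin
import Data.Fin.Permutation as Perm
open import Data.Fin.Properties using (opposite-prop; opposite-involutive; toℕ<n)
open import Data.List using (List; []; _∷_)
open import Data.List.Membership.Propositional using (_∈_)
open import Data.List.Relation.Unary.All using (lookup)
open import Data.List.Relation.Unary.Any using (here; there)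
open import Data.Nat using (zero; suc; _+_; _<_; _≥_; _<ᵇ_)
open import Data.Nat.DivMod using (m*n%n≡0)
open import Data.Nat.Properties
  using ( 0≢1+n; +-assoc; +-comm; +-suc; +-monoˡ-<; +-monoʳ-<; +-cancelˡ-<; +-cancelʳ-<
        ; +-identityʳ; m∸n+n≡m; ≤-refl; ≤-antisym; <ᵇ⇒<; <⇒<ᵇ; <ᵇ-reflects-<
        ; ≤-totalOrder; ≤-decTotalOrder; +-0-commutativeMonoid; module ≤-Reasoning)
open import Data.Nat.Tactic.RingSolver using (solve-∀)
open import Data.Product using (_,_; map₂)
open import Data.Product.Relation.Binary.Lex.NonStrict using (×-Lex; ×-totalOrder)
open import Data.Sum using (inj₁; inj₂)
open import Data.Vec using (tabulate; map; allFin)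
import Data.Vec as Vec
open import Data.Vec.Properties using (lookup∘tabulate; tabulate-allFin)
open import Function using (_∘_)
open import Level using (0ℓ)
open import Relation.Binary.Bundles using (TotalOrder)
open import Relation.Binary.PropositionalEquality
  using (refl; sym; trans; cong; cong₂; subst; module ≡-Reasoning)
open import Relation.Nullary using (¬_; contradiction)
open import Relation.Nullary.Reflects using (det; fromEquivalence)

open import Algebra.Properties.CommutativeMonoid.Sum +-0-commutativeMonoid
  using (sum; sum-syntax; sum-cong-≗; ∑-distrib-+; ∑-permute)

𝟙 : Bool → ℕ
𝟙 c = if c then 1 else 0

∑∑ : ∀ {m n} → (Fin m → Fin n → ℕ) → ℕ
∑∑ {m} {n} f = ∑[ i < m ] ∑[ j < n ] f i j

∑∑-cong : ∀ {m n} {f g : Fin m → Fin n → ℕ} → (∀ i j → f i j ≡ g i j) → ∑∑ f ≡ ∑∑ g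
∑∑-cong f≗g = sum-cong-≗ (λ i → sum-cong-≗ (f≗g i))

∑∑-distrib-+ : ∀ {m n} (f g : Fin m → Fin n → ℕ) →
  ∑∑ (λ i j → f i j + g i j) ≡ ∑∑ f + ∑∑ g
∑∑-distrib-+ f g =
  trans (sum-cong-≗ (λ i → ∑-distrib-+ (f i) (g i))) (∑-distrib-+ (λ i → sum (f i)) (λ i → sum (g i)))

reflect : Bool → ∀ {n} → Fin n → Fin n
reflect false i = i
reflect true  i = opposite i

reflect-involutive : ∀ β {n} (i : Fin n) → reflect β (reflect β i) ≡ i
reflect-involutive false i = refl
reflect-involutive true  i = opposite-involutive i

∑-reflect : ∀ β {n} (f : Fin n → ℕ) → sum f ≡ sum (f ∘ reflect β)
∑-reflect false f = refl
∑-reflect true  f = ∑-permute f Perm.reverse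

∑∑-reflect : ∀ β γ {m n} (f : Fin m → Fin n → ℕ) →
  ∑∑ f ≡ ∑∑ (λ i j → f (reflect β i) (reflect γ j))
∑∑-reflect β γ f =
  trans (sum-cong-≗ (λ i → ∑-reflect γ (f i))) (∑-reflect β (λ i → sum (f i ∘ reflect γ)))

sum-map-allFin : ∀ {n} (f : Fin n → ℕ) → Vec.sum (map f (allFin n)) ≡ sum f
sum-map-allFin f = trans (cong Vec.sum (sym (tabulate-allFin f))) (sum-tabulate f)
  where
  sum-tabulate : ∀ {n} (f : Fin n → ℕ) → Vec.sum (tabulate f) ≡ sum f
  sum-tabulate {zero}  f = refl
  sum-tabulate {suc n} f = cong (f Fin.zero +_) (sum-tabulate (f ∘ Fin.suc))

countWhere-∑∑ : ∀ {m n} (P : Fin m → Fin n → Bool) (b : Board m n) →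
  countWhere P b ≡ ∑∑ (λ i j → 𝟙 (blocked b i j ∧ P i j))
countWhere-∑∑ {m} {n} P b =
  trans (sum-map-allFin (λ i → Vec.sum (map (cell i) (allFin n)))) (sum-cong-≗ (sum-map-allFin ∘ cell))
  where
  cell : Fin m → Fin n → ℕ
  cell i j = 𝟙 (blocked b i j ∧ P i j)

countWhere-cong : ∀ {m n} {P Q : Fin m → Fin n → Bool} → (∀ i j → P i j ≡ Q i j) →
  (b : Board m n) → countWhere P b ≡ countWhere Q b
countWhere-cong {P = P} {Q} P≗Q b = begin
  countWhere P b
    ≡⟨ countWhere-∑∑ P b ⟩
  ∑∑ (λ i j → 𝟙 (blocked b i j ∧ P i j))
    ≡⟨ ∑∑-cong (λ i j → cong (λ c → 𝟙 (blocked b i j ∧ c)) (P≗Q i j)) ⟩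
  ∑∑ (λ i j → 𝟙 (blocked b i j ∧ Q i j))
    ≡⟨ countWhere-∑∑ Q b ⟨
  countWhere Q b
    ∎
  where open ≡-Reasoning

countWhere-split : ∀ {m n} (P : Fin m → Fin n → Bool) {Q Q′ : Fin m → Fin n → Bool} →
  (∀ i j → not (Q i j) ≡ Q′ i j) → (b : Board m n) →
  countWhere P b ≡ countWhere (λ i j → P i j ∧ Q i j) b + countWhere (λ i j → P i j ∧ Q′ i j) b
countWhere-split {m} {n} P {Q} {Q′} ¬Q≗Q′ b = begin
  countWhere P b
    ≡⟨ countWhere-∑∑ P b ⟩
  ∑∑ (λ i j → 𝟙 (blocked b i j ∧ P i j))
    ≡⟨ ∑∑-cong (λ i j → 𝟙-split (blocked b i j ∧ P i j) (Q i j) (Q′ i j) (¬Q≗Q′ i j)) ⟩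
  ∑∑ (λ i j → 𝟙 ((blocked b i j ∧ P i j) ∧ Q i j) + 𝟙 ((blocked b i j ∧ P i j) ∧ Q′ i j))
    ≡⟨ ∑∑-distrib-+ {m} {n} _ _ ⟩
  ∑∑ (λ i j → 𝟙 ((blocked b i j ∧ P i j) ∧ Q i j)) + ∑∑ (λ i j → 𝟙 ((blocked b i j ∧ P i j) ∧ Q′ i j))
    ≡⟨ cong₂ _+_ (∑∑-cong (λ i j → cong 𝟙 (∧-assoc (blocked b i j) (P i j) (Q i j))))
                 (∑∑-cong (λ i j → cong 𝟙 (∧-assoc (blocked b i j) (P i j) (Q′ i j)))) ⟩
  ∑∑ (λ i j → 𝟙 (blocked b i j ∧ (P i j ∧ Q i j))) + ∑∑ (λ i j → 𝟙 (blocked b i j ∧ (P i j ∧ Q′ i j)))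
    ≡⟨ cong₂ _+_ (countWhere-∑∑ _ b) (countWhere-∑∑ _ b) ⟨
  countWhere (λ i j → P i j ∧ Q i j) b + countWhere (λ i j → P i j ∧ Q′ i j) b
    ∎
  where
  open ≡-Reasoning
  𝟙-split : ∀ a q q′ → not q ≡ q′ → 𝟙 a ≡ 𝟙 (a ∧ q) + 𝟙 (a ∧ q′)
  𝟙-split false _     _ refl = refl
  𝟙-split true  false _ refl = refl
  𝟙-split true  true  _ refl = refl

rowFlip colFlip : G → Bool
rowFlip R0   = false
rowFlip H    = true
rowFlip V    = false
rowFlip R180 = true
colFlip R0   = false
colFlip H    = false
colFlip V    = true
colFlip R180 = true

blocked-tabulate : ∀ {m n} (f : Fin m → Fin n → Bool) i j →
  blocked (tabulate λ i → tabulate (f i)) i j ≡ f i j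
blocked-tabulate f i j =
  trans (cong (λ row → Vec.lookup row j) (lookup∘tabulate _ i)) (lookup∘tabulate (f i) j)

blocked-act : ∀ {m n} g (b : Board m n) i j →
  blocked (act g b) i j ≡ blocked b (reflect (rowFlip g) i) (reflect (colFlip g) j)
blocked-act R0   b i j = refl
blocked-act H    b i j = blocked-tabulate _ i j
blocked-act V    b i j = blocked-tabulate _ i j
blocked-act R180 b i j = blocked-tabulate _ i j

countWhere-act : ∀ {m n} g (P : Fin m → Fin n → Bool) (b : Board m n) →
  countWhere P (act g b) ≡ countWhere (λ i j → P (reflect (rowFlip g) i) (reflect (colFlip g) j)) b
countWhere-act g P b = begin
  countWhere P (act g b)
    ≡⟨ countWhere-∑∑ P (act g b) ⟩
  ∑∑ (λ i j → 𝟙 (blocked (act g b) i j ∧ P i j))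
    ≡⟨ ∑∑-cong (λ i j → cong (λ c → 𝟙 (c ∧ P i j)) (blocked-act g b i j)) ⟩
  ∑∑ (λ i j → 𝟙 (blocked b (ρ i) (γ j) ∧ P i j))
    ≡⟨ ∑∑-reflect (rowFlip g) (colFlip g) (λ i j → 𝟙 (blocked b (ρ i) (γ j) ∧ P i j)) ⟩
  ∑∑ (λ i j → 𝟙 (blocked b (ρ (ρ i)) (γ (γ j)) ∧ P (ρ i) (γ j)))
    ≡⟨ ∑∑-cong (λ i j → cong₂ (λ i′ j′ → 𝟙 (blocked b i′ j′ ∧ P (ρ i) (γ j)))
                              (reflect-involutive (rowFlip g) i) (reflect-involutive (colFlip g) j)) ⟩
  ∑∑ (λ i j → 𝟙 (blocked b i j ∧ P (ρ i) (γ j)))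
    ≡⟨ countWhere-∑∑ _ b ⟨
  countWhere (λ i j → P (ρ i) (γ j)) b
    ∎
  where
  open ≡-Reasoning
  ρ = reflect (rowFlip g)
  γ = reflect (colFlip g)

size-act : ∀ {m n} g (b : Board m n) → size (act g b) ≡ size b
size-act g = countWhere-act g (λ _ _ → true)

<ᵇ-suc≡not-<ᵇ : ∀ m k → (k <ᵇ suc m) ≡ not (m <ᵇ k)
<ᵇ-suc≡not-<ᵇ m       zero    = refl
<ᵇ-suc≡not-<ᵇ zero    (suc k) = refl
<ᵇ-suc≡not-<ᵇ (suc m) (suc k) = <ᵇ-suc≡not-<ᵇ m k

<ᵇ-complement : ∀ {m n k} → m + n ≡ 2 * k → (m <ᵇ k) ≡ (k <ᵇ n)
<ᵇ-complement {m} {n} {k} m+n≡2k =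
  det (<ᵇ-reflects-< m k) (fromEquivalence (k<n⇒m<k ∘ <ᵇ⇒< k n) (<⇒<ᵇ ∘ m<k⇒k<n))
  where
  open ≤-Reasoning
  m+n≡k+k : m + n ≡ k + k
  m+n≡k+k = trans m+n≡2k (cong (k +_) (+-identityʳ k))
  m<k⇒k<n : m < k → k < n
  m<k⇒k<n m<k = +-cancelˡ-< k k n (begin-strict
    k + k ≡⟨ m+n≡k+k ⟨
    m + n <⟨ +-monoˡ-< n m<k ⟩
    k + n ∎)
  k<n⇒m<k : k < n → m < k
  k<n⇒m<k k<n = +-cancelʳ-< n m k (begin-strict
    m + n ≡⟨ m+n≡k+k ⟩
    k + k <⟨ +-monoʳ-< k k<n ⟩
    k + n ∎)

toℕ-opposite-+ : ∀ {n} (i : Fin n) → toℕ (opposite i) + suc (toℕ i) ≡ n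
toℕ-opposite-+ i = trans (cong (_+ suc (toℕ i)) (opposite-prop i)) (m∸n+n≡m (toℕ<n i))

-- half true k holds on the indices below k and half false k on the others, so λ₁, λ₂, λ₃, λ₄
-- are quadrant k l x y for (x , y) = (true , true), (true , false), (false , false), (false , true).
half : Bool → ℕ → ∀ {n} → Fin n → Bool
half true  k i = toℕ i <ᵇ k
half false k i = k <ᵇ suc (toℕ i)

not-half : ∀ x k {n} (i : Fin n) → not (half x k i) ≡ half (not x) k i
not-half true  k i = sym (<ᵇ-suc≡not-<ᵇ (toℕ i) k)
not-half false k i = trans (cong not (<ᵇ-suc≡not-<ᵇ (toℕ i) k)) (not-involutive _)

half-reflect : ∀ β x k (i : Fin (2 * k)) → half x k (reflect β i) ≡ half (β xor x) k i
half-reflect false x     k i = refl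
half-reflect true  true  k i = <ᵇ-complement {k = k} (toℕ-opposite-+ i)
half-reflect true  false k i = sym (<ᵇ-complement {k = k} (begin
  toℕ i + suc (toℕ (opposite i)) ≡⟨ +-comm (toℕ i) _ ⟩
  suc (toℕ (opposite i) + toℕ i) ≡⟨ +-suc _ (toℕ i) ⟨
  toℕ (opposite i) + suc (toℕ i) ≡⟨ toℕ-opposite-+ i ⟩
  2 * k                          ∎))
  where open ≡-Reasoning

quadrant : ∀ {m n} (k l : ℕ) → Bool → Bool → Board m n → ℕ
quadrant k l x y = countWhere (λ i j → half x k i ∧ half y l j)

quadrant-act : ∀ k l g x y (b : Board (2 * k) (2 * l)) →
  quadrant k l x y (act g b) ≡ quadrant k l (rowFlip g xor x) (colFlip g xor y) b
quadrant-act k l g x y b = trans (countWhere-act g _ b)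
  (countWhere-cong (λ i j → cong₂ _∧_ (half-reflect (rowFlip g) x k i) (half-reflect (colFlip g) y l j)) b)

Quadruple : Set
Quadruple = ℕ × ℕ × ℕ × ℕ

total : Quadruple → ℕ
total (a , b , c , d) = a + b + c + d

partition : (k l : ℕ) → Board (2 * k) (2 * l) → Quadruple
partition k l b = λ₁ k l b , λ₂ k l b , λ₃ k l b , λ₄ k l b

size≡total-partition : ∀ k l (b : Board (2 * k) (2 * l)) → size b ≡ total (partition k l b)
size≡total-partition k l b = begin
  size b
    ≡⟨ countWhere-split _ (λ i _ → not-half true k i) b ⟩
  countWhere (λ i _ → half true k i) b + countWhere (λ i _ → half false k i) b
    ≡⟨ cong₂ _+_ (countWhere-split _ (λ _ j → not-half true l j) b)
                 (countWhere-split _ (λ _ j → not-half false l j) b) ⟩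
  (λ₁ k l b + λ₂ k l b) + (λ₃ k l b + λ₄ k l b)
    ≡⟨ +-assoc (λ₁ k l b + λ₂ k l b) _ _ ⟨
  total (partition k l b)
    ∎
  where open ≡-Reasoning

permute : G → Quadruple → Quadruple
permute R0   q               = q
permute H    (a , b , c , d) = d , c , b , a
permute V    (a , b , c , d) = b , a , d , c
permute R180 (a , b , c , d) = c , d , a , b

quadrants-act : ∀ k l g (b : Board (2 * k) (2 * l)) → partition k l (act g b) ≡
  ( quadrant k l (rowFlip g xor true)  (colFlip g xor true)  b
  , quadrant k l (rowFlip g xor true)  (colFlip g xor false) b
  , quadrant k l (rowFlip g xor false) (colFlip g xor false) b
  , quadrant k l (rowFlip g xor false) (colFlip g xor true)  b )
quadrants-act k l g b =
  cong₂ _,_ (quadrant-act k l g true true b)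
    (cong₂ _,_ (quadrant-act k l g true false b)
      (cong₂ _,_ (quadrant-act k l g false false b) (quadrant-act k l g false true b)))

partition-act : ∀ k l g (b : Board (2 * k) (2 * l)) →
  partition k l (act g b) ≡ permute g (partition k l b)
partition-act k l R0   = quadrants-act k l R0
partition-act k l H    = quadrants-act k l H
partition-act k l V    = quadrants-act k l V
partition-act k l R180 = quadrants-act k l R180

infixl 7 _·_
_·_ : G → G → G
R0   · g    = g
g    · R0   = g
H    · H    = R0
H    · V    = R180
H    · R180 = V
V    · H    = R180
V    · V    = R0
V    · R180 = H
R180 · H    = V
R180 · V    = H
R180 · R180 = R0

-- Every case is refl for a variable q, by η for pairs.
permute-· : ∀ f g q → permute f (permute g q) ≡ permute (f · g) q
permute-· R0   g    q = refl
permute-· H    R0   q = refl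
permute-· H    H    q = refl
permute-· H    V    q = refl
permute-· H    R180 q = refl
permute-· V    R0   q = refl
permute-· V    H    q = refl
permute-· V    V    q = refl
permute-· V    R180 q = refl
permute-· R180 R0   q = refl
permute-· R180 H    q = refl
permute-· R180 V    q = refl
permute-· R180 R180 q = refl

·-cancelʳ : ∀ h g → h · g · g ≡ h
·-cancelʳ R0   R0   = refl
·-cancelʳ R0   H    = refl
·-cancelʳ R0   V    = refl
·-cancelʳ R0   R180 = refl
·-cancelʳ H    R0   = refl
·-cancelʳ H    H    = refl
·-cancelʳ H    V    = refl
·-cancelʳ H    R180 = refl
·-cancelʳ V    R0   = refl
·-cancelʳ V    H    = refl
·-cancelʳ V    V    = refl
·-cancelʳ V    R180 = refl
·-cancelʳ R180 R0   = refl
·-cancelʳ R180 H    = refl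
·-cancelʳ R180 V    = refl
·-cancelʳ R180 R180 = refl

-- InBbar k l r b unfolds to InB r b × Canonical (partition k l b).
Canonical : Quadruple → Set
Canonical (a , b , c , d) =
  (a ≥ b × a ≥ c × a ≥ d) × (a ≡ b → c ≥ d) × (a ≡ c → b ≥ d) × (a ≡ d → b ≥ c)

canonical-fixed : ∀ f u → Canonical u → Canonical (permute f u) → permute f u ≡ u
canonical-fixed R0 u _ _ = refl
canonical-fixed H (a , b , c , d) ((_ , _ , d≤a) , _ , _ , a≡d⇒c≤b) ((_ , _ , a≤d) , _ , _ , d≡a⇒b≤c)
  with ≤-antisym a≤d d≤a
... | refl with ≤-antisym (d≡a⇒b≤c refl) (a≡d⇒c≤b refl)
... | refl = refl
canonical-fixed V (a , b , c , d) ((b≤a , _) , a≡b⇒d≤c , _) ((a≤b , _) , b≡a⇒c≤d , _)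
  with ≤-antisym a≤b b≤a
... | refl with ≤-antisym (b≡a⇒c≤d refl) (a≡b⇒d≤c refl)
... | refl = refl
canonical-fixed R180 (a , b , c , d) ((_ , c≤a , _) , _ , a≡c⇒d≤b , _) ((_ , a≤c , _) , _ , c≡a⇒b≤d , _)
  with ≤-antisym a≤c c≤a
... | refl with ≤-antisym (c≡a⇒b≤d refl) (a≡c⇒d≤b refl)
... | refl = refl

¬odd-*2 : ∀ x → ¬ Odd (x * 2)
¬odd-*2 x odd = 0≢1+n (trans (sym (m*n%n≡0 x 2)) odd)

odd-fixed⇒R0 : ∀ f u → Odd (total u) → permute f u ≡ u → f ≡ R0
odd-fixed⇒R0 R0   _               _   _    = refl
odd-fixed⇒R0 H    (a , b , _ , _) odd refl = contradiction (subst Odd (H-total a b) odd) (¬odd-*2 (a + b))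
  where
  H-total : ∀ a b → a + b + b + a ≡ (a + b) * 2
  H-total = solve-∀
odd-fixed⇒R0 V    (a , _ , c , _) odd refl = contradiction (subst Odd (V-total a c) odd) (¬odd-*2 (a + c))
  where
  V-total : ∀ a c → a + a + c + c ≡ (a + c) * 2
  V-total = solve-∀
odd-fixed⇒R0 R180 (a , b , _ , _) odd refl = contradiction (subst Odd (R180-total a b) odd) (¬odd-*2 (a + b))
  where
  R180-total : ∀ a b → a + b + a + b ≡ (a + b) * 2
  R180-total = solve-∀

canonical-unique : ∀ g h t → Odd (total (permute g t)) →
  Canonical (permute g t) → Canonical (permute h t) → h ≡ g
canonical-unique g h t odd canonical-g canonical-h = begin
  h          ≡⟨ ·-cancelʳ h g ⟨
  h · g · g  ≡⟨ cong (_· g) (odd-fixed⇒R0 (h · g) u odd (canonical-fixed (h · g) u canonical-g canonical-hg)) ⟩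
  R0 · g     ≡⟨⟩
  g          ∎
  where
  open ≡-Reasoning
  u : Quadruple
  u = permute g t
  h-via-g : permute h t ≡ permute (h · g) u
  h-via-g = trans (cong (λ f → permute f t) (sym (·-cancelʳ h g))) (sym (permute-· (h · g) g t))
  canonical-hg : Canonical (permute (h · g) u)
  canonical-hg = subst Canonical h-via-g canonical-h

lexOrder : TotalOrder 0ℓ 0ℓ 0ℓ
lexOrder =
  ×-totalOrder ≤-decTotalOrder (×-totalOrder ≤-decTotalOrder (×-totalOrder ≤-decTotalOrder ≤-totalOrder))

open import Data.List.Extrema lexOrder using (argmax; f[xs]≤f[argmax])

module _ {B : Set} (R : B → B → Set) {x y : ℕ} {p q : B} where

  lex-head : ×-Lex _≡_ _≤_ R (x , p) (y , q) → x ≤ y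
  lex-head (inj₁ (x≤y , _)) = x≤y
  lex-head (inj₂ (refl , _)) = ≤-refl

  lex-tail : ×-Lex _≡_ _≤_ R (x , p) (y , q) → x ≡ y → R p q
  lex-tail (inj₁ (_ , x≢y)) x≡y = contradiction x≡y x≢y
  lex-tail (inj₂ (_ , pRq)) _   = pRq

_≤²_ : ℕ × ℕ → ℕ × ℕ → Set
_≤²_ = ×-Lex _≡_ _≤_ _≤_

_≤³_ : ℕ × ℕ × ℕ → ℕ × ℕ × ℕ → Set
_≤³_ = ×-Lex _≡_ _≤_ _≤²_

_≤ₗₑₓ_ : Quadruple → Quadruple → Set
_≤ₗₑₓ_ = TotalOrder._≤_ lexOrder

lex-max⇒canonical : ∀ u → (∀ f → permute f u ≤ₗₑₓ u) → Canonical u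
lex-max⇒canonical (a , b , c , d) max =
  (lex-head _≤³_ (max V) , lex-head _≤³_ (max R180) , lex-head _≤³_ (max H)) ,
  (λ a≡b → lex-head _≤_ (lex-tail _≤²_ (lex-tail _≤³_ (max V) (sym a≡b)) a≡b)) ,
  (λ a≡c → lex-head _≤²_ (lex-tail _≤³_ (max R180) (sym a≡c))) ,
  (λ a≡d → lex-head _≤²_ (lex-tail _≤³_ (max H) (sym a≡d)))

orbit : List G
orbit = R0 ∷ H ∷ V ∷ R180 ∷ []

∈-orbit : ∀ g → g ∈ orbit
∈-orbit R0   = here refl
∈-orbit H    = there (here refl)
∈-orbit V    = there (there (here refl))
∈-orbit R180 = there (there (there (here refl)))

maximiser : (F : G → Quadruple) → Σ G λ g → ∀ h → F h ≤ₗₑₓ F g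
maximiser F = argmax F R0 orbit , λ h → lookup (f[xs]≤f[argmax] {f = F} R0 orbit) (∈-orbit h)

orbit-max⇒canonical : ∀ t g → (∀ h → permute h t ≤ₗₑₓ permute g t) → Canonical (permute g t)
orbit-max⇒canonical t g max = lex-max⇒canonical (permute g t) λ f →
  subst (_≤ₗₑₓ permute g t) (sym (permute-· f g t)) (max (f · g))

canonical-exists : ∀ t → Σ G λ g → Canonical (permute g t)
canonical-exists t = map₂ (λ {g} → orbit-max⇒canonical t g) (maximiser (λ h → permute h t))

InBbar-representative : ∀ k l r (b : Board (2 * k) (2 * l)) → InB r b →
  Σ G λ g → InBbar k l r (act g b)
InBbar-representative k l r b b∈B = map₂ (λ {g} canonical-g →
    trans (size-act g b) b∈B , subst Canonical (sym (partition-act k l g b)) canonical-g)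
  (canonical-exists (partition k l b))

InBbar-representative-unique : ∀ k l r (b : Board (2 * k) (2 * l)) → Odd r → ∀ g h →
  InBbar k l r (act g b) → InBbar k l r (act h b) → h ≡ g
InBbar-representative-unique k l r b odd-r g h (gb∈B , canonical-gb) (_ , canonical-hb) =
  canonical-unique g h (partition k l b) (subst Odd r≡total odd-r) (moved g canonical-gb) (moved h canonical-hb)
  where
  moved : ∀ f → Canonical (partition k l (act f b)) → Canonical (permute f (partition k l b))
  moved f = subst Canonical (partition-act k l f b)
  r≡total : r ≡ total (permute g (partition k l b))
  r≡total = trans (sym gb∈B) (trans (size≡total-partition k l (act g b)) (cong total (partition-act k l g b)))

proposition7p1 : (k l : ℕ) → 1 ≤ k → 1 ≤ l → k ≢ l →
    (r : ℕ) → Odd r → 1 ≤ r → r ≤ 4 * k * l →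
    (b : Board (2 * k) (2 * l)) → InB r b →
    Σ (Board (2 * k) (2 * l)) (λ b' → SameOrbit b b' × InBbar k l r b' ×
      ((b'' : Board (2 * k) (2 * l)) → SameOrbit b b'' → InBbar k l r b'' → b'' ≡ b'))
proposition7p1 k l _ _ _ r odd-r _ _ b b∈B = representative (InBbar-representative k l r b b∈B)
  where
  representative : Σ G (λ g → InBbar k l r (act g b)) →
    Σ (Board (2 * k) (2 * l)) λ b' → SameOrbit b b' × InBbar k l r b' ×
      (∀ b'' → SameOrbit b b'' → InBbar k l r b'' → b'' ≡ b')
  representative (g , gb∈B̄) = act g b , (g , refl) , gb∈B̄ , λ where
    _ (h , refl) hb∈B̄ → cong (λ f → act f b) (InBbar-representative-unique k l r b odd-r g h gb∈B̄ hb∈B̄)
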